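{- Let $\zeta$ be the zeta function of the poset $[\mathbf{2}]^*$ under composition order, and for $m\ge0$ let $\zeta^m$ denote its $m$-th convolution power. Define rational functions $a_m(x),b_m(x)$ by $a_0(x)=x$, $b_0(x)=x^2$, and for $m\ge1$ $$a_m(x)=a_{m-1}(x)+b_{m-1}(x),\qquad b_m(x)=\frac{b_{m-1}(x)}{1-a_{m-1}(x)}.$$ If $u\in[\mathbf{2}]^*$ has type $t(u)=(l_1,l_2)$, then for all $m\ge0$ $$\sum_w\zeta^m(u,w)\,x^{|w|}=a_m(x)^{l_1}b_m(x)^{l_2}\prod_{i=0}^{m-1}\frac{1}{1-a_i(x)-b_i(x)}$$ (sum over $w\in[\mathbf{2}]^*$). Furthermore, for all $m\ge0$, $$a_m(x)=\frac{x\,\bar a_m(x)}{d_m(x)},\qquad b_m(x)=\frac{x^2}{d_m(x)\,d_{m+1}(x)},$$ where $$\bar a_m(x)=\sum_i(-1)^{\lfloor i/2\rfloor}\binom{\lfloor (m+i)/2\rfloor}{i}x^i,\qquad d_m(x)=\sum_i(-1)^{\lceil i/2\rceil}\binom{\lfloor (m+i-1)/2\rfloor}{i}x^i.$$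
   Context: Composition order: for words $u,w$ over positive integers, $u\le w$ iff there are indices $i_1<\cdots<i_l$ with $l=\ell(u)$ and $u(j)\le w(i_j)$ for all $j$; $[\mathbf{2}]^*$ is the poset of words with letters in $\{1,2\}$. $\zeta(u,w)=1$ if $u\le w$ and $0$ otherwise; convolution is $(\phi*\psi)(u,w)=\sum_v\phi(u,v)\psi(v,w)$ and $\zeta^0$ is the identity $\delta$. $|w|$ is the sum of the letters of $w$; the type $t(u)=(l_1,l_2)$ records the numbers of $1$'s and $2$'s in $u$. Binomial coefficient conventions: $\binom{n}{k}=0$ if $k<0$ or $k>n$, and $\binom{n}{0}=1$ for every integer $n$ (including negative $n$). -}

module Defs where

open import Data.Nat as ℕ using (ℕ; zero; suc; _∸_)
open import Data.Nat.Combinatorics using (_C_)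
open import Data.Nat.ListAction using (sum)
open import Data.Nat.Base using (_/_)
open import Data.Integer as ℤ using (ℤ; +_; -_; 0ℤ; 1ℤ)
open import Data.Fin using (Fin; toℕ)
open import Data.Vec as Vec using (Vec; _∷_; []; head; zipWith; tabulate)
open import Data.List as List using (List; _∷_; []; concatMap; upTo; filter; length; map)
open import Data.List.Properties using (≡-dec)
open import Data.List.Relation.Binary.Sublist.Heterogeneous using (Sublist)
open import Data.List.Relation.Binary.Sublist.Heterogeneous.Properties using (sublist?)
open import Relation.Binary.PropositionalEquality using (_≡_; refl)
open import Relation.Nullary using (Dec; yes; no; does)
open import Data.Bool using (if_then_else_)

Series : Set
Series = ℕ → ℤ

infix 4 _≈_
_≈_ : Series → Series → Set
f ≈ g = ∀ n → f n ≡ g n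

sumTo : ℕ → (ℕ → ℤ) → ℤ
sumTo zero    f = f 0
sumTo (suc n) f = sumTo n f ℤ.+ f (suc n)

𝟙 : Series
𝟙 zero    = 1ℤ
𝟙 (suc _) = 0ℤ

X : Series
X 1 = 1ℤ
X _ = 0ℤ

infixl 6 _⊕_ _⊖_
infixl 7 _⊛_
_⊕_ : Series → Series → Series
(f ⊕ g) n = f n ℤ.+ g n

_⊖_ : Series → Series → Series
(f ⊖ g) n = f n ℤ.- g n

_⊛_ : Series → Series → Series
(f ⊛ g) n = sumTo n (λ k → f k ℤ.* g (n ∸ k))

infixr 8 _^ₛ_
_^ₛ_ : Series → ℕ → Series
f ^ₛ zero  = 𝟙
f ^ₛ suc k = f ⊛ (f ^ₛ k)

prodBelow : ℕ → (ℕ → Series) → Series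
prodBelow zero    f = 𝟙
prodBelow (suc m) f = prodBelow m f ⊛ f m

-- Multiplicative inverse of a unit of ℤ[[x]], i.e. a series whose constant
-- term c is ±1 (so c⁻¹ = c):  g 0 = c,  g n = - c · Σ_{k=1}^{n} f k · g (n-k).
-- invPrefix f n = [g n, g (n-1), …, g 0].
invPrefix : Series → (n : ℕ) → Vec ℤ (suc n)
invPrefix f zero    = f 0 ∷ []
invPrefix f (suc n) =
  let p = invPrefix f n in
  (- (f 0 ℤ.* Vec.foldr _ ℤ._+_ 0ℤ
        (zipWith ℤ._*_ (tabulate (λ (j : Fin (suc n)) → f (suc (toℕ j)))) p)))
  ∷ p

inv : Series → Series
inv f n = head (invPrefix f n)

-- The rational functions a_m, b_m (as power series; 1 - a_{m-1} has
-- constant term 1, hence is a unit).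

mutual
  a : ℕ → Series
  a zero    = X
  a (suc m) = a m ⊕ b m

  b : ℕ → Series
  b zero    = X ⊛ X
  b (suc m) = b m ⊛ inv (𝟙 ⊖ a m)

sgn : ℕ → ℤ
sgn zero          = 1ℤ
sgn (suc zero)    = - 1ℤ
sgn (suc (suc k)) = sgn k

abar : ℕ → Series
abar m i = sgn (i / 2) ℤ.* + (((m ℕ.+ i) / 2) C i)

-- For i = 0 the coefficient is C(·,0) = 1 (also when m = 0, where the upper
-- index is ⌊-1/2⌋ = -1, by the convention C(n,0) = 1 for every integer n).
-- For i = suc j the upper index ⌊(m+j)/2⌋ is a natural number, and
-- ⌈(suc j)/2⌉ = (suc j + 1) / 2.
d : ℕ → Series
d m zero    = 1ℤ
d m (suc j) = sgn ((suc j ℕ.+ 1) / 2) ℤ.* + (((m ℕ.+ j) / 2) C (suc j))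

data Letter : Set where
  one two : Letter

val : Letter → ℕ
val one = 1
val two = 2

_≟L_ : (x y : Letter) → Dec (x ≡ y)
one ≟L one = yes refl
one ≟L two = no (λ ())
two ≟L one = no (λ ())
two ≟L two = yes refl

Word : Set
Word = List Letter

_≤L_ : Letter → Letter → Set
x ≤L y = val x ℕ.≤ val y

_≼_ : Word → Word → Set
u ≼ w = Sublist _≤L_ u w

∣_∣ʷ : Word → ℕ
∣ w ∣ʷ = sum (map val w)

count₁ count₂ : Word → ℕ
count₁ u = length (filter (λ x → x ≟L one) u)
count₂ u = length (filter (λ x → x ≟L two) u)

wordsOfLength : ℕ → List Word
wordsOfLength zero    = [] ∷ []
wordsOfLength (suc k) = concatMap (λ w → (one ∷ w) ∷ (two ∷ w) ∷ []) (wordsOfLength k)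

wordsUpTo : ℕ → List Word
wordsUpTo k = concatMap wordsOfLength (upTo (suc k))

sumOver : {A : Set} → List A → (A → ℤ) → ℤ
sumOver xs f = List.foldr ℤ._+_ 0ℤ (map f xs)

ζ : Word → Word → ℤ
ζ u w = if does (sublist? (λ x y → val x ℕ.≤? val y) u w) then 1ℤ else 0ℤ

δ : Word → Word → ℤ
δ u w = if does (≡-dec _≟L_ u w) then 1ℤ else 0ℤ

-- ζ^0 = δ,  ζ^(m+1)(u,w) = Σ_v ζ^m(u,v) ζ(v,w).  The sum over all v ∈ [2]*
-- is restricted to words of length ≤ ℓ(w); all other terms vanish since
-- ζ(v,w) = 0 when ℓ(v) > ℓ(w).
ζ^ : ℕ → Word → Word → ℤ
ζ^ zero    u w = δ u w
ζ^ (suc m) u w = sumOver (wordsUpTo (length w)) (λ v → ζ^ m u v ℤ.* ζ v w)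

-- Σ_w ζ^m(u,w) x^{|w|}: coefficient of x^n is the sum over words w with
-- |w| = n (all of which have length ≤ n).
genSeries : ℕ → Word → Series
genSeries m u n =
  sumOver (filter (λ w → ∣ w ∣ʷ ℕ.≟ n) (wordsUpTo n)) (λ w → ζ^ m u w)

{-# OPTIONS --safe #-}
module Submission where

-- Replace x^|w| by a weight that is multiplicative in the letters of w: a letter 1 contributes α and
-- a letter 2 contributes β, so that (α , β) = (x , x²) gives back x^|w|. Splitting off the first letter
-- of the words w ≥ v gives Σ_w ζ(v,w) weight_{α,β}(w) = weight_{α′,β′}(v) / (1 - α - β) with
-- α′ = α + β and β′ = β / (1 - α). Since ζ^{m+1}(u,w) = Σ_v ζ^m(u,v) ζ(v,w), induction on m with the
-- pair (α , β) generalised turns (x , x²) into its iterates (a_m , b_m) and collects the factors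
-- 1 / (1 - a_i - b_i).
--
-- After clearing denominators the closed forms reduce to the recurrences d_m = d_{m+2} + x ā_m and
-- ā_{m+2} = ā_m + x d_{m+2} (Pascal's rule, coefficientwise) and to the Casoratian identity
-- ā_{m+1} d_m - ā_m d_{m+1} = x, whose left-hand side the recurrences show to be invariant under m ↦ m + 2.

open import Defs
open import Algebra.Bundles using (CommutativeRing)
import Algebra.Construct.Pointwise as Pointwise
import Algebra.Properties.Group as GroupProperties
import Algebra.Properties.Ring as RingProperties
import Algebra.Solver.Ring.NaturalCoefficients.Default as NaturalCoefficients
open import Data.Bool using (true; false; if_then_else_)
open import Data.Empty using (⊥-elim)
open import Data.Fin using (Fin; toℕ) renaming (zero to fzero; suc to fsuc)
open import Data.Integer as ℤ using (ℤ; +_; -_; 0ℤ; 1ℤ; _+_; _*_)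
import Data.Integer.Properties as ℤP
open import Data.Integer.Tactic.RingSolver using (solve-∀)
open import Data.List using (List; _∷_; []; _++_; length; filter; concatMap; applyUpTo)
open import Data.List.Relation.Binary.Sublist.Heterogeneous.Properties using (sublist?; length-mono-≤)
open import Data.Nat as ℕ using (ℕ; zero; suc; _∸_; _/_; z≤n; s≤s; _≤′_; ≤′-refl; ≤′-step)
open import Data.Nat.Combinatorics using (_C_; nCk+nC[k+1]≡[n+1]C[k+1]; k>n⇒nCk≡0)
import Data.Nat.DivMod as DivMod
open import Data.Nat.GeneralisedArithmetic using (fold; iterate; iterate-is-fold)
import Data.Nat.Properties as ℕP
open import Data.Product using (_×_; _,_; proj₁; proj₂)
open import Data.Vec as Vec using (Vec; lookup; tabulate; zipWith)
open import Level using (0ℓ)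
open import Relation.Binary.Bundles using (Setoid)
open import Relation.Binary.PropositionalEquality
import Relation.Binary.Reasoning.Setoid as SetoidReasoning
open import Relation.Nullary using (Dec; yes; no; does)

open import Algebra.Properties.CommutativeSemigroup ℤP.+-commutativeSemigroup
  using () renaming (interchange to +-interchange)

private variable A B : Set

-- Finite sums

sumTo-cong : ∀ n {f g : ℕ → ℤ} → (∀ k → k ℕ.≤ n → f k ≡ g k) → sumTo n f ≡ sumTo n g
sumTo-cong zero    f≗g = f≗g 0 z≤n
sumTo-cong (suc n) f≗g =
  cong₂ _+_ (sumTo-cong n (λ k k≤n → f≗g k (ℕP.m≤n⇒m≤1+n k≤n))) (f≗g (suc n) ℕP.≤-refl)

sumTo-cong′ : ∀ n {f g : ℕ → ℤ} → (∀ k → f k ≡ g k) → sumTo n f ≡ sumTo n g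
sumTo-cong′ n f≗g = sumTo-cong n (λ k _ → f≗g k)

sumTo-zero : ∀ n (f : ℕ → ℤ) → (∀ k → k ℕ.≤ n → f k ≡ 0ℤ) → sumTo n f ≡ 0ℤ
sumTo-zero zero    f f≗0 = f≗0 0 z≤n
sumTo-zero (suc n) f f≗0 =
  cong₂ _+_ (sumTo-zero n f (λ k k≤n → f≗0 k (ℕP.m≤n⇒m≤1+n k≤n))) (f≗0 (suc n) ℕP.≤-refl)

sumTo-+ : ∀ n (f g : ℕ → ℤ) → sumTo n (λ k → f k + g k) ≡ sumTo n f + sumTo n g
sumTo-+ zero    f g = refl
sumTo-+ (suc n) f g = trans (cong (_+ (f (suc n) + g (suc n))) (sumTo-+ n f g))
                            (+-interchange (sumTo n f) (sumTo n g) (f (suc n)) (g (suc n)))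

sumTo-*ˡ : ∀ n c (f : ℕ → ℤ) → c * sumTo n f ≡ sumTo n (λ k → c * f k)
sumTo-*ˡ zero    c f = refl
sumTo-*ˡ (suc n) c f =
  trans (ℤP.*-distribˡ-+ c (sumTo n f) (f (suc n))) (cong (_+ c * f (suc n)) (sumTo-*ˡ n c f))

sumTo-*ʳ : ∀ n c (f : ℕ → ℤ) → sumTo n f * c ≡ sumTo n (λ k → f k * c)
sumTo-*ʳ n c f = trans (ℤP.*-comm (sumTo n f) c)
                       (trans (sumTo-*ˡ n c f) (sumTo-cong′ n (λ k → ℤP.*-comm c (f k))))

sumTo-unfoldˡ : ∀ n (f : ℕ → ℤ) → sumTo (suc n) f ≡ f 0 + sumTo n (λ k → f (suc k))
sumTo-unfoldˡ zero    f = refl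
sumTo-unfoldˡ (suc n) f =
  trans (cong (_+ f (suc (suc n))) (sumTo-unfoldˡ n f)) (ℤP.+-assoc (f 0) _ _)

sumTo-reverse : ∀ n (f : ℕ → ℤ) → sumTo n f ≡ sumTo n (λ k → f (n ∸ k))
sumTo-reverse zero    f = refl
sumTo-reverse (suc n) f = begin
  sumTo (suc n) f                           ≡⟨ sumTo-unfoldˡ n f ⟩
  f 0 + sumTo n (λ k → f (suc k))           ≡⟨ ℤP.+-comm (f 0) _ ⟩
  sumTo n (λ k → f (suc k)) + f 0           ≡⟨ cong (_+ f 0) (sumTo-reverse n (λ k → f (suc k))) ⟩
  sumTo n (λ k → f (suc (n ∸ k))) + f 0
    ≡⟨ cong₂ _+_ (sumTo-cong n λ k k≤n → cong f (sym (ℕP.+-∸-assoc 1 k≤n))) (cong f (sym (ℕP.n∸n≡0 n))) ⟩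
  sumTo (suc n) (λ k → f (suc n ∸ k))       ∎
  where open ≡-Reasoning

sumTo-triangle : ∀ n (F : ℕ → ℕ → ℤ) →
  sumTo n (λ k → sumTo k (λ j → F j k)) ≡ sumTo n (λ j → sumTo (n ∸ j) (λ t → F j (j ℕ.+ t)))
sumTo-triangle zero    F = refl
sumTo-triangle (suc n) F = begin
  sumTo n (λ k → sumTo k (λ j → F j k)) + (sumTo n (λ j → F j (suc n)) + F (suc n) (suc n))
    ≡⟨ cong (_+ (sumTo n (λ j → F j (suc n)) + F (suc n) (suc n))) (sumTo-triangle n F) ⟩
  sumTo n row + (sumTo n (λ j → F j (suc n)) + F (suc n) (suc n))
    ≡⟨ ℤP.+-assoc (sumTo n row) _ _ ⟨
  (sumTo n row + sumTo n (λ j → F j (suc n))) + F (suc n) (suc n)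
    ≡⟨ cong₂ _+_ (trans (sym (sumTo-+ n row (λ j → F j (suc n)))) (sumTo-cong n extendRow))
                 (cong (F (suc n)) (sym (ℕP.+-identityʳ (suc n)))) ⟩
  sumTo n (λ j → sumTo (suc n ∸ j) (λ t → F j (j ℕ.+ t))) + F (suc n) (suc n ℕ.+ 0)
    ≡⟨ cong (λ z → sumTo n (λ j → sumTo (suc n ∸ j) (λ t → F j (j ℕ.+ t)))
                   + sumTo z (λ t → F (suc n) (suc n ℕ.+ t)))
            (sym (ℕP.n∸n≡0 n)) ⟩
  sumTo (suc n) (λ j → sumTo (suc n ∸ j) (λ t → F j (j ℕ.+ t))) ∎
  where
  open ≡-Reasoning
  row : ℕ → ℤ
  row j = sumTo (n ∸ j) (λ t → F j (j ℕ.+ t))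
  extendRow : ∀ j → j ℕ.≤ n → row j + F j (suc n) ≡ sumTo (suc n ∸ j) (λ t → F j (j ℕ.+ t))
  extendRow j j≤n rewrite ℕP.+-∸-assoc 1 j≤n =
    cong (λ z → row j + F j z) (sym (trans (ℕP.+-suc j (n ∸ j)) (cong suc (ℕP.m+[n∸m]≡n j≤n))))

sumTo-vanishingTail : ∀ {j N} f → (∀ k → j ℕ.< k → f k ≡ 0ℤ) → j ≤′ N → sumTo N f ≡ sumTo j f
sumTo-vanishingTail f f≗0 ≤′-refl        = refl
sumTo-vanishingTail f f≗0 (≤′-step j≤′N) =
  trans (cong₂ _+_ (sumTo-vanishingTail f f≗0 j≤′N) (f≗0 _ (s≤s (ℕP.≤′⇒≤ j≤′N)))) (ℤP.+-identityʳ _)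

sumOver-cong : ∀ (xs : List A) {f g : A → ℤ} → (∀ x → f x ≡ g x) → sumOver xs f ≡ sumOver xs g
sumOver-cong []       f≗g = refl
sumOver-cong (x ∷ xs) f≗g = cong₂ _+_ (f≗g x) (sumOver-cong xs f≗g)

sumOver-zero : ∀ (xs : List A) → sumOver xs (λ _ → 0ℤ) ≡ 0ℤ
sumOver-zero []       = refl
sumOver-zero (x ∷ xs) = trans (ℤP.+-identityˡ _) (sumOver-zero xs)

sumOver-++ : ∀ (xs ys : List A) f → sumOver (xs ++ ys) f ≡ sumOver xs f + sumOver ys f
sumOver-++ []       ys f = sym (ℤP.+-identityˡ _)
sumOver-++ (x ∷ xs) ys f = trans (cong (_+_ (f x)) (sumOver-++ xs ys f)) (sym (ℤP.+-assoc (f x) _ _))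

sumOver-concatMap : ∀ (g : A → List B) xs f →
  sumOver (concatMap g xs) f ≡ sumOver xs (λ x → sumOver (g x) f)
sumOver-concatMap g []       f = refl
sumOver-concatMap g (x ∷ xs) f =
  trans (sumOver-++ (g x) _ f) (cong (_+_ (sumOver (g x) f)) (sumOver-concatMap g xs f))

sumOver-applyUpTo : ∀ (g : ℕ → A) n f → sumOver (applyUpTo g (suc n)) f ≡ sumTo n (λ k → f (g k))
sumOver-applyUpTo g zero    f = ℤP.+-identityʳ (f (g 0))
sumOver-applyUpTo g (suc n) f = trans (cong (_+_ (f (g 0))) (sumOver-applyUpTo (λ k → g (suc k)) n f))
                                      (sym (sumTo-unfoldˡ n (λ k → f (g k))))

sumOver-+ : ∀ (xs : List A) f g → sumOver xs (λ x → f x + g x) ≡ sumOver xs f + sumOver xs g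
sumOver-+ []       f g = refl
sumOver-+ (x ∷ xs) f g = trans (cong (_+_ (f x + g x)) (sumOver-+ xs f g))
                               (+-interchange (f x) (g x) (sumOver xs f) (sumOver xs g))

sumOver-*ˡ : ∀ (xs : List A) c f → c * sumOver xs f ≡ sumOver xs (λ x → c * f x)
sumOver-*ˡ []       c f = ℤP.*-zeroʳ c
sumOver-*ˡ (x ∷ xs) c f = trans (ℤP.*-distribˡ-+ c (f x) _) (cong (_+_ (c * f x)) (sumOver-*ˡ xs c f))

sumOver-*ʳ : ∀ (xs : List A) c f → sumOver xs f * c ≡ sumOver xs (λ x → f x * c)
sumOver-*ʳ xs c f = trans (ℤP.*-comm (sumOver xs f) c)
                          (trans (sumOver-*ˡ xs c f) (sumOver-cong xs (λ x → ℤP.*-comm c (f x))))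

sumOver-swap : ∀ (xs : List A) (ys : List B) (F : A → B → ℤ) →
  sumOver xs (λ x → sumOver ys (F x)) ≡ sumOver ys (λ y → sumOver xs (λ x → F x y))
sumOver-swap []       ys F = sym (sumOver-zero ys)
sumOver-swap (x ∷ xs) ys F = trans (cong (_+_ (sumOver ys (F x))) (sumOver-swap xs ys F))
                                   (sym (sumOver-+ ys (F x) (λ y → sumOver xs (λ x → F x y))))

sumOver-sumTo : ∀ (xs : List A) n (F : A → ℕ → ℤ) →
  sumOver xs (λ x → sumTo n (F x)) ≡ sumTo n (λ k → sumOver xs (λ x → F x k))
sumOver-sumTo xs zero    F = refl
sumOver-sumTo xs (suc n) F = trans (sumOver-+ xs (λ x → sumTo n (F x)) (λ x → F x (suc n)))
                                   (cong (_+ sumOver xs (λ x → F x (suc n))) (sumOver-sumTo xs n F))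

sumOver-filter : ∀ {P : A → Set} (P? : ∀ x → Dec (P x)) xs f →
  sumOver (filter P? xs) f ≡ sumOver xs (λ x → if does (P? x) then f x else 0ℤ)
sumOver-filter P? []       f = refl
sumOver-filter P? (x ∷ xs) f with does (P? x)
... | true  = cong (_+_ (f x)) (sumOver-filter P? xs f)
... | false = trans (sumOver-filter P? xs f) (sym (ℤP.+-identityˡ _))

-- The ring ℤ[[x]]

≈-setoid : Setoid 0ℓ 0ℓ
≈-setoid = record { isEquivalence = Pointwise.isEquivalence ℕ (isEquivalence {A = ℤ}) }

open Setoid ≈-setoid
  using () renaming (refl to ≈-refl; sym to ≈-sym; trans to ≈-trans; reflexive to ≈-reflexive)

module ≈-Reasoning = SetoidReasoning ≈-setoid

⊛-cong : ∀ {f f′ g g′} → f ≈ f′ → g ≈ g′ → f ⊛ g ≈ f′ ⊛ g′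
⊛-cong f≈f′ g≈g′ n = sumTo-cong′ n (λ k → cong₂ _*_ (f≈f′ k) (g≈g′ (n ∸ k)))

⊛-comm : ∀ f g → f ⊛ g ≈ g ⊛ f
⊛-comm f g n = trans (sumTo-reverse n _) (sumTo-cong n λ k k≤n →
  trans (cong (λ i → f (n ∸ k) * g i) (ℕP.m∸[m∸n]≡n k≤n)) (ℤP.*-comm (f (n ∸ k)) (g k)))

⊛-assoc : ∀ f g h → (f ⊛ g) ⊛ h ≈ f ⊛ (g ⊛ h)
⊛-assoc f g h n = begin
  sumTo n (λ k → sumTo k (λ j → f j * g (k ∸ j)) * h (n ∸ k))
    ≡⟨ sumTo-cong′ n (λ k → sumTo-*ʳ k (h (n ∸ k)) _) ⟩
  sumTo n (λ k → sumTo k (λ j → f j * g (k ∸ j) * h (n ∸ k)))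
    ≡⟨ sumTo-triangle n (λ j k → f j * g (k ∸ j) * h (n ∸ k)) ⟩
  sumTo n (λ j → sumTo (n ∸ j) (λ t → f j * g (j ℕ.+ t ∸ j) * h (n ∸ (j ℕ.+ t))))
    ≡⟨ sumTo-cong′ n (λ j → sumTo-cong′ (n ∸ j) (λ t →
         trans (cong₂ (λ i i′ → f j * g i * h i′) (ℕP.m+n∸m≡n j t) (sym (ℕP.∸-+-assoc n j t)))
               (ℤP.*-assoc (f j) (g t) (h (n ∸ j ∸ t))))) ⟩
  sumTo n (λ j → sumTo (n ∸ j) (λ t → f j * (g t * h (n ∸ j ∸ t))))
    ≡⟨ sumTo-cong′ n (λ j → sumTo-*ˡ (n ∸ j) (f j) _) ⟨
  sumTo n (λ j → f j * sumTo (n ∸ j) (λ t → g t * h (n ∸ j ∸ t))) ∎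
  where open ≡-Reasoning

⊛-identityˡ : ∀ f → 𝟙 ⊛ f ≈ f
⊛-identityˡ f zero    = ℤP.*-identityˡ (f 0)
⊛-identityˡ f (suc n) = trans (sumTo-unfoldˡ n _)
  (trans (cong₂ _+_ (ℤP.*-identityˡ (f (suc n))) (sumTo-zero n _ (λ _ _ → refl))) (ℤP.+-identityʳ (f (suc n))))

⊛-identityʳ : ∀ f → f ⊛ 𝟙 ≈ f
⊛-identityʳ f = ≈-trans (⊛-comm f 𝟙) (⊛-identityˡ f)

⊛-distribˡ : ∀ f g h → f ⊛ (g ⊕ h) ≈ f ⊛ g ⊕ f ⊛ h
⊛-distribˡ f g h n =
  trans (sumTo-cong′ n (λ k → ℤP.*-distribˡ-+ (f k) (g (n ∸ k)) (h (n ∸ k)))) (sumTo-+ n _ _)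

⊛-distribʳ : ∀ f g h → (g ⊕ h) ⊛ f ≈ g ⊛ f ⊕ h ⊛ f
⊛-distribʳ f g h n = begin
  ((g ⊕ h) ⊛ f) n         ≡⟨ ⊛-comm (g ⊕ h) f n ⟩
  (f ⊛ (g ⊕ h)) n         ≡⟨ ⊛-distribˡ f g h n ⟩
  (f ⊛ g) n + (f ⊛ h) n   ≡⟨ cong₂ _+_ (⊛-comm f g n) (⊛-comm f h n) ⟩
  (g ⊛ f) n + (h ⊛ f) n   ∎
  where open ≡-Reasoning

ℤ[[x]] : CommutativeRing 0ℓ 0ℓ
ℤ[[x]] = record
  { _≈_ = _≈_ ; _+_ = _⊕_ ; _*_ = _⊛_ ; -_ = λ f n → - f n ; 0# = λ _ → 0ℤ ; 1# = 𝟙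
  ; isCommutativeRing = record
    { isRing = record
      { +-isAbelianGroup = Pointwise.isAbelianGroup ℕ ℤP.+-0-isAbelianGroup
      ; *-cong = ⊛-cong
      ; *-assoc = ⊛-assoc
      ; *-identity = ⊛-identityˡ , ⊛-identityʳ
      ; distrib = ⊛-distribˡ , ⊛-distribʳ
      }
    ; *-comm = ⊛-comm
    }
  }

open CommutativeRing ℤ[[x]] using () renaming (+-cong to ⊕-cong; 0# to 0ₛ)
open NaturalCoefficients (CommutativeRing.commutativeSemiring ℤ[[x]]) using (solve; _:=_; _:+_; _:*_; con)
open GroupProperties (CommutativeRing.+-group ℤ[[x]]) using (x≈z//y) renaming (∙-cancelʳ to ⊕-cancelʳ)
open RingProperties (CommutativeRing.ring ℤ[[x]]) using (x[y-z]≈xy-xz)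

X⊛-suc : ∀ f n → (X ⊛ f) (suc n) ≡ f n
X⊛-suc f n = trans (sumTo-unfoldˡ n _) (trans (ℤP.+-identityˡ _) (trans (sumTo-cong′ n X-shift) (⊛-identityˡ f n)))
  where
  X-shift : ∀ k → X (suc k) * f (n ∸ k) ≡ 𝟙 k * f (n ∸ k)
  X-shift zero    = refl
  X-shift (suc k) = refl

foldr-zipWith-tabulate : ∀ n (g h : ℕ → ℤ) (v : Vec ℤ (suc n)) → (∀ j → lookup v j ≡ h (toℕ j)) →
  Vec.foldr _ _+_ 0ℤ (zipWith _*_ (tabulate (λ (j : Fin (suc n)) → g (toℕ j))) v) ≡ sumTo n (λ j → g j * h j)
foldr-zipWith-tabulate zero    g h (x Vec.∷ Vec.[]) v≗h = trans (ℤP.+-identityʳ _) (cong (g 0 *_) (v≗h fzero))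
foldr-zipWith-tabulate (suc n) g h (x Vec.∷ v)      v≗h = trans
  (cong₂ _+_ (cong (g 0 *_) (v≗h fzero))
             (foldr-zipWith-tabulate n (λ j → g (suc j)) (λ j → h (suc j)) v (λ j → v≗h (fsuc j))))
  (sym (sumTo-unfoldˡ n (λ j → g j * h j)))

lookup-invPrefix : ∀ f n (j : Fin (suc n)) → lookup (invPrefix f n) j ≡ inv f (n ∸ toℕ j)
lookup-invPrefix f zero    fzero    = refl
lookup-invPrefix f (suc n) fzero    = refl
lookup-invPrefix f (suc n) (fsuc j) = lookup-invPrefix f n j

inv-suc : ∀ f n → inv f (suc n) ≡ - (f 0 * sumTo n (λ j → f (suc j) * inv f (n ∸ j)))
inv-suc f n = cong (λ s → - (f 0 * s))
  (foldr-zipWith-tabulate n (λ j → f (suc j)) (λ j → inv f (n ∸ j)) (invPrefix f n) (lookup-invPrefix f n))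

⊛-inverseʳ : ∀ u → u 0 ≡ 1ℤ → u ⊛ inv u ≈ 𝟙
⊛-inverseʳ u u₀≡1 zero    rewrite u₀≡1 = refl
⊛-inverseʳ u u₀≡1 (suc n) = begin
  sumTo (suc n) (λ k → u k * inv u (suc n ∸ k))   ≡⟨ sumTo-unfoldˡ n _ ⟩
  u 0 * inv u (suc n) + s                         ≡⟨ cong (λ i → u 0 * i + s) (inv-suc u n) ⟩
  u 0 * - (u 0 * s) + s                           ≡⟨ cong (λ c → c * - (c * s) + s) u₀≡1 ⟩
  1ℤ * - (1ℤ * s) + s                             ≡⟨ cong (_+ s) (trans (ℤP.*-identityˡ _) (cong -_ (ℤP.*-identityˡ s))) ⟩
  - s + s                                         ≡⟨ ℤP.+-inverseˡ s ⟩
  0ℤ                                              ∎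
  where
  open ≡-Reasoning
  s = sumTo n (λ j → u (suc j) * inv u (n ∸ j))

x⊛u≈y⇒x≈y⊛inv-u : ∀ u {x y} → u 0 ≡ 1ℤ → x ⊛ u ≈ y → x ≈ y ⊛ inv u
x⊛u≈y⇒x≈y⊛inv-u u {x} {y} u₀≡1 x⊛u≈y = begin
  x                  ≈⟨ ⊛-identityʳ x ⟨
  x ⊛ 𝟙              ≈⟨ ⊛-cong (≈-refl {x}) (⊛-inverseʳ u u₀≡1) ⟨
  x ⊛ (u ⊛ inv u)    ≈⟨ ⊛-assoc x u (inv u) ⟨
  (x ⊛ u) ⊛ inv u    ≈⟨ ⊛-cong x⊛u≈y (≈-refl {inv u}) ⟩
  y ⊛ inv u          ∎
  where open ≈-Reasoning

⊛-cancelʳ : ∀ u {x y} → u 0 ≡ 1ℤ → x ⊛ u ≈ y ⊛ u → x ≈ y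
⊛-cancelʳ u {x} {y} u₀≡1 x⊛u≈y⊛u =
  ≈-trans (x⊛u≈y⇒x≈y⊛inv-u u u₀≡1 x⊛u≈y⊛u) (≈-sym (x⊛u≈y⇒x≈y⊛inv-u u {y} u₀≡1 (≈-refl {y ⊛ u})))

y≈p⊕y⊛c⇒y⊛[𝟙⊖c]≈p : ∀ y p c → y ≈ p ⊕ y ⊛ c → y ⊛ (𝟙 ⊖ c) ≈ p
y≈p⊕y⊛c⇒y⊛[𝟙⊖c]≈p y p c y≈p⊕yc = begin
  y ⊛ (𝟙 ⊖ c)       ≈⟨ x[y-z]≈xy-xz y 𝟙 c ⟩
  y ⊛ 𝟙 ⊖ y ⊛ c     ≈⟨ (λ n → cong (ℤ._- (y ⊛ c) n) (⊛-identityʳ y n)) ⟩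
  y ⊖ y ⊛ c         ≈⟨ x≈z//y p (y ⊛ c) y (≈-sym y≈p⊕yc) ⟨
  p                 ∎
  where open ≈-Reasoning

ConstantFree : Series → Set
ConstantFree f = f 0 ≡ 0ℤ

BothConstantFree : Series × Series → Set
BothConstantFree (α , β) = ConstantFree α × ConstantFree β

step : Series × Series → Series × Series
step (α , β) = α ⊕ β , β ⊛ inv (𝟙 ⊖ α)

step-constantFree : ∀ p → BothConstantFree p → BothConstantFree (step p)
step-constantFree (α , β) (α₀≡0 , β₀≡0) = cong₂ _+_ α₀≡0 β₀≡0 , cong (_* inv (𝟙 ⊖ α) 0) β₀≡0

ab-constantFree : ∀ m → BothConstantFree (a m , b m)
ab-constantFree zero    = refl , refl
ab-constantFree (suc m) = step-constantFree (a m , b m) (ab-constantFree m)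

ab-iterate : ∀ m → iterate step (X , X ⊛ X) m ≡ (a m , b m)
ab-iterate m = trans (sym (iterate-is-fold (X , X ⊛ X) step m)) (fold-ab m)
  where
  fold-ab : ∀ m → fold (X , X ⊛ X) step m ≡ (a m , b m)
  fold-ab zero    = refl
  fold-ab (suc m) = cong step (fold-ab m)

-- Closed forms of a_m and b_m

sgn-suc : ∀ k → sgn (suc k) ≡ - sgn k
sgn-suc zero    = refl
sgn-suc (suc k) = sym (trans (cong -_ (sgn-suc k)) (ℤP.neg-involutive (sgn k)))

[2+n]/2≡1+n/2 : ∀ n → suc (suc n) / 2 ≡ suc (n / 2)
[2+n]/2≡1+n/2 n = DivMod.m/n≡1+[m∸n]/n {suc (suc n)} (s≤s (s≤s z≤n))

pascal : ∀ n k → + (suc n C suc k) ≡ + (n C k) + + (n C suc k)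
pascal n k = trans (cong +_ (sym (nCk+nC[k+1]≡[n+1]C[k+1] n k))) (ℤP.pos-+ (n C k) (n C suc k))

k>n⇒s*nCk≡0 : ∀ s {n k} → n ℕ.< k → s * + (n C k) ≡ 0ℤ
k>n⇒s*nCk≡0 s n<k rewrite k>n⇒nCk≡0 n<k = ℤP.*-zeroʳ s

abar-0 : abar 0 ≈ 𝟙
abar-0 zero    = refl
abar-0 (suc i) = k>n⇒s*nCk≡0 (sgn (suc i / 2)) (DivMod.m/n<m (suc i) 2 (s≤s (s≤s z≤n)))

abar-1 : abar 1 ≈ 𝟙 ⊕ X
abar-1 zero          = refl
abar-1 (suc zero)    = refl
abar-1 (suc (suc i)) =
  trans (cong (λ n → sgn (suc (suc i) / 2) * + (n C suc (suc i))) ([2+n]/2≡1+n/2 (suc i)))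
        (k>n⇒s*nCk≡0 (sgn (suc (suc i) / 2)) (s≤s (DivMod.m/n<m (suc i) 2 (s≤s (s≤s z≤n)))))

d-0 : d 0 ≈ 𝟙
d-0 zero    = refl
d-0 (suc j) = k>n⇒s*nCk≡0 (sgn ((suc j ℕ.+ 1) / 2)) (s≤s (DivMod.m/n≤m j 2))

d-1 : d 1 ≈ 𝟙
d-1 zero    = refl
d-1 (suc j) = k>n⇒s*nCk≡0 (sgn ((suc j ℕ.+ 1) / 2)) (DivMod.m/n<m (suc j) 2 (s≤s (s≤s z≤n)))

d-suc : ∀ m j → d (suc m) j ≡ sgn ((j ℕ.+ 1) / 2) * + ((m ℕ.+ j) / 2 C j)
d-suc m zero    = refl
d-suc m (suc j) = cong (λ n → sgn ((suc j ℕ.+ 1) / 2) * + (n / 2 C suc j)) (sym (ℕP.+-suc m j))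

d-recurrence : ∀ m → d m ≈ d (suc (suc m)) ⊕ X ⊛ abar m
d-recurrence m zero    = refl
d-recurrence m (suc j) = sym (begin
  sgn ((suc j ℕ.+ 1) / 2) * + (suc (suc (m ℕ.+ j)) / 2 C suc j) + (X ⊛ abar m) (suc j)
    ≡⟨ cong₂ _+_ (cong₂ (λ σ n → σ * + (n C suc j)) sign ([2+n]/2≡1+n/2 (m ℕ.+ j))) (X⊛-suc (abar m) j) ⟩
  - s * + (suc N C suc j) + s * + (N C j)            ≡⟨ cong (λ t → - s * t + s * + (N C j)) (pascal N j) ⟩
  - s * (+ (N C j) + + (N C suc j)) + s * + (N C j)  ≡⟨ cancel s (+ (N C j)) (+ (N C suc j)) ⟩
  - s * + (N C suc j)                                ≡⟨ cong (_* + (N C suc j)) sign ⟨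
  sgn ((suc j ℕ.+ 1) / 2) * + (N C suc j)            ∎)
  where
  open ≡-Reasoning
  N = (m ℕ.+ j) / 2
  s = sgn (j / 2)
  sign : sgn ((suc j ℕ.+ 1) / 2) ≡ - s
  sign = trans (cong sgn (trans (cong (λ i → suc i / 2) (ℕP.+-comm j 1)) ([2+n]/2≡1+n/2 j))) (sgn-suc (j / 2))
  cancel : ∀ s p q → - s * (p + q) + s * p ≡ - s * q
  cancel = solve-∀

abar-recurrence : ∀ m → abar (suc (suc m)) ≈ abar m ⊕ X ⊛ d (suc (suc m))
abar-recurrence m zero    = refl
abar-recurrence m (suc j) = begin
  s * + (suc (suc (m ℕ.+ suc j)) / 2 C suc j)  ≡⟨ cong (λ n → s * + (n C suc j)) ([2+n]/2≡1+n/2 (m ℕ.+ suc j)) ⟩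
  s * + (suc M C suc j)                        ≡⟨ cong (s *_) (pascal M j) ⟩
  s * (+ (M C j) + + (M C suc j))              ≡⟨ distrib-swap s (+ (M C j)) (+ (M C suc j)) ⟩
  s * + (M C suc j) + s * + (M C j)            ≡⟨ cong (λ t → s * + (M C suc j) + t) dTerm ⟨
  abar m (suc j) + (X ⊛ d (suc (suc m))) (suc j) ∎
  where
  open ≡-Reasoning
  s = sgn (suc j / 2)
  M = (m ℕ.+ suc j) / 2
  distrib-swap : ∀ s p q → s * (p + q) ≡ s * q + s * p
  distrib-swap = solve-∀
  dTerm : (X ⊛ d (suc (suc m))) (suc j) ≡ s * + (M C j)
  dTerm = trans (X⊛-suc (d (suc (suc m))) j) (trans (d-suc (suc m) j)
            (cong₂ (λ e n → sgn (e / 2) * + (n / 2 C j)) (ℕP.+-comm j 1) (sym (ℕP.+-suc m j))))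

casoratian-step : ∀ x a₀ a₁ a₂ a₃ d₀ d₁ d₂ d₃ →
  d₀ ≈ d₂ ⊕ x ⊛ a₀ → d₁ ≈ d₃ ⊕ x ⊛ a₁ → a₂ ≈ a₀ ⊕ x ⊛ d₂ → a₃ ≈ a₁ ⊕ x ⊛ d₃ →
  a₁ ⊛ d₀ ≈ a₀ ⊛ d₁ ⊕ x → a₃ ⊛ d₂ ≈ a₂ ⊛ d₃ ⊕ x
casoratian-step x a₀ a₁ a₂ a₃ d₀ d₁ d₂ d₃ d₀≈ d₁≈ a₂≈ a₃≈ a₁d₀≈ = begin
  a₃ ⊛ d₂
    ≈⟨ ⊛-cong a₃≈ (≈-refl {d₂}) ⟩
  (a₁ ⊕ x ⊛ d₃) ⊛ d₂
    ≈⟨ solve 4 (λ a₁ x d₂ d₃ → (a₁ :+ x :* d₃) :* d₂ := a₁ :* d₂ :+ x :* d₂ :* d₃) ≈-refl a₁ x d₂ d₃ ⟩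
  a₁ ⊛ d₂ ⊕ x ⊛ d₂ ⊛ d₃
    ≈⟨ ⊕-cong a₁d₂≈ (≈-refl {x ⊛ d₂ ⊛ d₃}) ⟩
  a₀ ⊛ d₃ ⊕ x ⊕ x ⊛ d₂ ⊛ d₃
    ≈⟨ solve 4 (λ a₀ x d₂ d₃ → a₀ :* d₃ :+ x :+ x :* d₂ :* d₃ := (a₀ :+ x :* d₂) :* d₃ :+ x) ≈-refl a₀ x d₂ d₃ ⟩
  (a₀ ⊕ x ⊛ d₂) ⊛ d₃ ⊕ x
    ≈⟨ ⊕-cong (⊛-cong a₂≈ (≈-refl {d₃})) (≈-refl {x}) ⟨
  a₂ ⊛ d₃ ⊕ x ∎
  where
  open ≈-Reasoning
  a₁d₂≈ : a₁ ⊛ d₂ ≈ a₀ ⊛ d₃ ⊕ x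
  a₁d₂≈ = ⊕-cancelʳ (x ⊛ a₀ ⊛ a₁) (a₁ ⊛ d₂) (a₀ ⊛ d₃ ⊕ x) (begin
    a₁ ⊛ d₂ ⊕ x ⊛ a₀ ⊛ a₁
      ≈⟨ solve 4 (λ a₀ a₁ x d₂ → a₁ :* d₂ :+ x :* a₀ :* a₁ := a₁ :* (d₂ :+ x :* a₀)) ≈-refl a₀ a₁ x d₂ ⟩
    a₁ ⊛ (d₂ ⊕ x ⊛ a₀)
      ≈⟨ ⊛-cong (≈-refl {a₁}) d₀≈ ⟨
    a₁ ⊛ d₀
      ≈⟨ a₁d₀≈ ⟩
    a₀ ⊛ d₁ ⊕ x
      ≈⟨ ⊕-cong (⊛-cong (≈-refl {a₀}) d₁≈) (≈-refl {x}) ⟩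
    a₀ ⊛ (d₃ ⊕ x ⊛ a₁) ⊕ x
      ≈⟨ solve 4 (λ a₀ a₁ x d₃ → a₀ :* (d₃ :+ x :* a₁) :+ x := a₀ :* d₃ :+ x :+ x :* a₀ :* a₁) ≈-refl a₀ a₁ x d₃ ⟩
    a₀ ⊛ d₃ ⊕ x ⊕ x ⊛ a₀ ⊛ a₁ ∎)

abar-d-casoratian : ∀ m → abar (suc m) ⊛ d m ≈ abar m ⊛ d (suc m) ⊕ X
abar-d-casoratian zero = begin
  abar 1 ⊛ d 0      ≈⟨ ⊛-cong abar-1 d-0 ⟩
  (𝟙 ⊕ X) ⊛ 𝟙       ≈⟨ solve 1 (λ x → (con 1 :+ x) :* con 1 := con 1 :* con 1 :+ x) ≈-refl X ⟩
  𝟙 ⊛ 𝟙 ⊕ X         ≈⟨ ⊕-cong (⊛-cong abar-0 d-1) (≈-refl {X}) ⟨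
  abar 0 ⊛ d 1 ⊕ X  ∎
  where open ≈-Reasoning
abar-d-casoratian (suc zero) = begin
  abar 2 ⊛ d 1              ≈⟨ ⊛-cong (≈-trans (abar-recurrence 0) (⊕-cong abar-0 (≈-refl {X ⊛ d 2}))) d-1 ⟩
  (𝟙 ⊕ X ⊛ d 2) ⊛ 𝟙         ≈⟨ ⊛-identityʳ (𝟙 ⊕ X ⊛ d 2) ⟩
  𝟙 ⊕ X ⊛ d 2               ≈⟨ ⊕-cong 𝟙≈d₂⊕X (≈-refl {X ⊛ d 2}) ⟩
  (d 2 ⊕ X) ⊕ X ⊛ d 2       ≈⟨ solve 2 (λ d₂ x → (d₂ :+ x) :+ x :* d₂ := (con 1 :+ x) :* d₂ :+ x)
                                       ≈-refl (d 2) X ⟩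
  (𝟙 ⊕ X) ⊛ d 2 ⊕ X         ≈⟨ ⊕-cong (⊛-cong abar-1 (≈-refl {d 2})) (≈-refl {X}) ⟨
  abar 1 ⊛ d 2 ⊕ X          ∎
  where
  open ≈-Reasoning
  𝟙≈d₂⊕X : 𝟙 ≈ d 2 ⊕ X
  𝟙≈d₂⊕X = ≈-trans (≈-sym d-0) (≈-trans (d-recurrence 0)
              (⊕-cong (≈-refl {d 2}) (≈-trans (⊛-cong (≈-refl {X}) abar-0) (⊛-identityʳ X))))
abar-d-casoratian (suc (suc m)) =
  casoratian-step X (abar m) (abar (suc m)) (abar (suc (suc m))) (abar (suc (suc (suc m))))
                    (d m) (d (suc m)) (d (suc (suc m))) (d (suc (suc (suc m))))
                    (d-recurrence m) (d-recurrence (suc m)) (abar-recurrence m) (abar-recurrence (suc m))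
                    (abar-d-casoratian m)

closed-forms-cleared : ∀ m → (a m ⊛ d m ≈ X ⊛ abar m) × (b m ⊛ (d m ⊛ d (suc m)) ≈ X ⊛ X)
closed-forms-cleared zero =
    ⊛-cong (≈-refl {X}) (≈-trans d-0 (≈-sym abar-0))
  , ≈-trans (⊛-cong (≈-refl {X ⊛ X}) (≈-trans (⊛-cong d-0 d-1) (⊛-identityˡ 𝟙))) (⊛-identityʳ (X ⊛ X))
closed-forms-cleared (suc m) = a′d₁≈ , b′d₁d₂≈
  where
  open ≈-Reasoning
  A₀ = abar m
  A₁ = abar (suc m)
  D₀ = d m
  D₁ = d (suc m)
  D₂ = d (suc (suc m))
  u = 𝟙 ⊖ a m
  ad≈ = proj₁ (closed-forms-cleared m)
  bdd≈ = proj₂ (closed-forms-cleared m)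
  a′d₁≈ : (a m ⊕ b m) ⊛ D₁ ≈ X ⊛ A₁
  a′d₁≈ = ⊛-cancelʳ D₀ refl (begin
    (a m ⊕ b m) ⊛ D₁ ⊛ D₀
      ≈⟨ solve 4 (λ α β d₀ d₁ → (α :+ β) :* d₁ :* d₀ := α :* d₀ :* d₁ :+ β :* (d₀ :* d₁))
                 ≈-refl (a m) (b m) D₀ D₁ ⟩
    a m ⊛ D₀ ⊛ D₁ ⊕ b m ⊛ (D₀ ⊛ D₁)     ≈⟨ ⊕-cong (⊛-cong ad≈ (≈-refl {D₁})) bdd≈ ⟩
    X ⊛ A₀ ⊛ D₁ ⊕ X ⊛ X                 ≈⟨ solve 3 (λ x a₀ d₁ → x :* a₀ :* d₁ :+ x :* x := x :* (a₀ :* d₁ :+ x))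
                                                  ≈-refl X A₀ D₁ ⟩
    X ⊛ (A₀ ⊛ D₁ ⊕ X)                   ≈⟨ ⊛-cong (≈-refl {X}) (abar-d-casoratian m) ⟨
    X ⊛ (A₁ ⊛ D₀)                       ≈⟨ ⊛-assoc X A₁ D₀ ⟨
    X ⊛ A₁ ⊛ D₀                         ∎)
  D₀⊛u≈D₂ : D₀ ⊛ u ≈ D₂
  D₀⊛u≈D₂ = y≈p⊕y⊛c⇒y⊛[𝟙⊖c]≈p D₀ D₂ (a m)
              (≈-trans (d-recurrence m) (⊕-cong (≈-refl {D₂}) (≈-trans (≈-sym ad≈) (⊛-comm (a m) D₀))))
  b′d₁d₂≈ : b m ⊛ inv u ⊛ (D₁ ⊛ D₂) ≈ X ⊛ X
  b′d₁d₂≈ = begin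
    b m ⊛ inv u ⊛ (D₁ ⊛ D₂)
      ≈⟨ ⊛-cong (≈-refl {b m ⊛ inv u}) (⊛-cong (≈-refl {D₁}) D₀⊛u≈D₂) ⟨
    b m ⊛ inv u ⊛ (D₁ ⊛ (D₀ ⊛ u))
      ≈⟨ solve 5 (λ β v d₀ d₁ w → β :* v :* (d₁ :* (d₀ :* w)) := β :* (d₀ :* d₁) :* (w :* v))
                 ≈-refl (b m) (inv u) D₀ D₁ u ⟩
    b m ⊛ (D₀ ⊛ D₁) ⊛ (u ⊛ inv u)
      ≈⟨ ⊛-cong bdd≈ (⊛-inverseʳ u (cong (λ c → 1ℤ ℤ.- c) (proj₁ (ab-constantFree m)))) ⟩
    X ⊛ X ⊛ 𝟙                           ≈⟨ ⊛-identityʳ (X ⊛ X) ⟩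
    X ⊛ X                               ∎

closed-forms : ∀ m → (a m ≈ X ⊛ abar m ⊛ inv (d m)) × (b m ≈ (X ⊛ X) ⊛ inv (d m ⊛ d (suc m)))
closed-forms m = x⊛u≈y⇒x≈y⊛inv-u (d m) refl (proj₁ (closed-forms-cleared m))
               , x⊛u≈y⇒x≈y⊛inv-u (d m ⊛ d (suc m)) refl (proj₂ (closed-forms-cleared m))

sumOver-wordsUpTo : ∀ n H → sumOver (wordsUpTo n) H ≡ sumTo n (λ k → sumOver (wordsOfLength k) H)
sumOver-wordsUpTo n H = trans (sumOver-concatMap wordsOfLength (applyUpTo (λ k → k) (suc n)) H)
                              (sumOver-applyUpTo (λ k → k) n (λ k → sumOver (wordsOfLength k) H))

sumOver-wordsOfLength-suc : ∀ k H →
  sumOver (wordsOfLength (suc k)) H ≡ sumOver (wordsOfLength k) (λ w → H (one ∷ w) + H (two ∷ w))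
sumOver-wordsOfLength-suc k H = trans (sumOver-concatMap _ (wordsOfLength k) H)
  (sumOver-cong (wordsOfLength k) (λ w → trans (sym (ℤP.+-assoc (H (one ∷ w)) _ _)) (ℤP.+-identityʳ _)))

sumOver-wordsOfLength-zero : ∀ k H → (∀ w → length w ≡ k → H w ≡ 0ℤ) → sumOver (wordsOfLength k) H ≡ 0ℤ
sumOver-wordsOfLength-zero zero    H H≗0 = cong (_+ 0ℤ) (H≗0 [] refl)
sumOver-wordsOfLength-zero (suc k) H H≗0 = trans (sumOver-wordsOfLength-suc k H)
  (sumOver-wordsOfLength-zero k _ λ w ∣w∣≡k →
    cong₂ _+_ (H≗0 (one ∷ w) (cong suc ∣w∣≡k)) (H≗0 (two ∷ w) (cong suc ∣w∣≡k)))

sumOver-wordsUpTo-≤ : ∀ {j N} H → (∀ w → j ℕ.< length w → H w ≡ 0ℤ) → j ℕ.≤ N →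
  sumOver (wordsUpTo N) H ≡ sumOver (wordsUpTo j) H
sumOver-wordsUpTo-≤ {j} {N} H H≗0 j≤N = begin
  sumOver (wordsUpTo N) H                       ≡⟨ sumOver-wordsUpTo N H ⟩
  sumTo N (λ k → sumOver (wordsOfLength k) H)   ≡⟨ sumTo-vanishingTail _ longer≗0 (ℕP.≤⇒≤′ j≤N) ⟩
  sumTo j (λ k → sumOver (wordsOfLength k) H)   ≡⟨ sumOver-wordsUpTo j H ⟨
  sumOver (wordsUpTo j) H                       ∎
  where
  open ≡-Reasoning
  longer≗0 : ∀ k → j ℕ.< k → sumOver (wordsOfLength k) H ≡ 0ℤ
  longer≗0 k j<k = sumOver-wordsOfLength-zero k H (λ w ∣w∣≡k → H≗0 w (subst (j ℕ.<_) (sym ∣w∣≡k) j<k))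

sumOver-wordsUpTo-suc : ∀ n H →
  sumOver (wordsUpTo (suc n)) H ≡ H [] + sumOver (wordsUpTo n) (λ w → H (one ∷ w) + H (two ∷ w))
sumOver-wordsUpTo-suc n H = begin
  sumOver (wordsUpTo (suc n)) H                        ≡⟨ sumOver-wordsUpTo (suc n) H ⟩
  sumTo (suc n) (λ k → sumOver (wordsOfLength k) H)    ≡⟨ sumTo-unfoldˡ n _ ⟩
  (H [] + 0ℤ) + sumTo n (λ k → sumOver (wordsOfLength (suc k)) H)
    ≡⟨ cong₂ _+_ (ℤP.+-identityʳ (H [])) (sumTo-cong′ n (λ k → sumOver-wordsOfLength-suc k H)) ⟩
  H [] + sumTo n (λ k → sumOver (wordsOfLength k) (λ w → H (one ∷ w) + H (two ∷ w)))
    ≡⟨ cong (_+_ (H [])) (sumOver-wordsUpTo n _) ⟨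
  H [] + sumOver (wordsUpTo n) (λ w → H (one ∷ w) + H (two ∷ w)) ∎
  where open ≡-Reasoning

-- Summable families of series indexed by words

x^_∣_ : ℕ → Series → Set
x^ p ∣ f = ∀ k → k ℕ.< p → f k ≡ 0ℤ

x^1∣ : ∀ {f} → ConstantFree f → x^ 1 ∣ f
x^1∣ f₀≡0 zero    _        = f₀≡0
x^1∣ f₀≡0 (suc k) (s≤s ())

x^-∣-⊛ : ∀ p q {f g} → x^ p ∣ f → x^ q ∣ g → x^ (p ℕ.+ q) ∣ (f ⊛ g)
x^-∣-⊛ p q {f} {g} xᵖ∣f xᑫ∣g k k<p+q = sumTo-zero k _ term
  where
  term : ∀ j → j ℕ.≤ k → f j * g (k ∸ j) ≡ 0ℤ
  term j j≤k with j ℕ.<? p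
  ... | yes j<p = cong (_* g (k ∸ j)) (xᵖ∣f j j<p)
  ... | no  j≮p = trans (cong (f j *_) (xᑫ∣g (k ∸ j) k∸j<q)) (ℤP.*-zeroʳ (f j))
    where
    k∸j<q : k ∸ j ℕ.< q
    k∸j<q = subst (k ∸ j ℕ.<_) (ℕP.m+n∸m≡n j q)
              (ℕP.∸-monoˡ-< (ℕP.<-≤-trans k<p+q (ℕP.+-monoˡ-≤ q (ℕP.≮⇒≥ j≮p))) j≤k)

infixr 8 _·ₛ_
_·ₛ_ : ℤ → Series → Series
(c ·ₛ f) n = c * f n

·ₛ-⊛ : ∀ c f g → c ·ₛ (f ⊛ g) ≈ (c ·ₛ f) ⊛ g
·ₛ-⊛ c f g n = trans (sumTo-*ˡ n c _) (sumTo-cong′ n (λ k → sym (ℤP.*-assoc c (f k) (g (n ∸ k)))))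

Summable : (Word → Series) → Set
Summable F = ∀ w → x^ length w ∣ F w

summable-·ₛ : ∀ (c : Word → ℤ) F → Summable F → Summable (λ w → c w ·ₛ F w)
summable-·ₛ c F F-summable w k k<∣w∣ = trans (cong (c w *_) (F-summable w k k<∣w∣)) (ℤP.*-zeroʳ (c w))

summable-∷ : ∀ ℓ F → Summable F → Summable (λ w → F (ℓ ∷ w))
summable-∷ ℓ F F-summable w k k<∣w∣ = F-summable (ℓ ∷ w) k (ℕP.m<n⇒m<1+n k<∣w∣)

-- Σ_w F w for a summable family F: only the words of length ≤ n contribute to the n-th coefficient.
Σʷ : (Word → Series) → Series
Σʷ F n = sumOver (wordsUpTo n) (λ w → F w n)

Σʷ-cong : ∀ {F G} → (∀ w → F w ≈ G w) → Σʷ F ≈ Σʷ G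
Σʷ-cong F≈G n = sumOver-cong (wordsUpTo n) (λ w → F≈G w n)

Σʷ-zero : Σʷ (λ _ → 0ₛ) ≈ 0ₛ
Σʷ-zero n = sumOver-zero (wordsUpTo n)

Σʷ-unfold : ∀ F → Summable F → Σʷ F ≈ F [] ⊕ Σʷ (λ w → F (one ∷ w)) ⊕ Σʷ (λ w → F (two ∷ w))
Σʷ-unfold F F-summable n = begin
  sumOver (wordsUpTo n) (λ w → F w n)
    ≡⟨ sumOver-wordsUpTo-≤ (λ w → F w n) (λ w n<∣w∣ → F-summable w n n<∣w∣) (ℕP.n≤1+n n) ⟨
  sumOver (wordsUpTo (suc n)) (λ w → F w n)
    ≡⟨ sumOver-wordsUpTo-suc n (λ w → F w n) ⟩
  F [] n + sumOver (wordsUpTo n) (λ w → F (one ∷ w) n + F (two ∷ w) n)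
    ≡⟨ cong (_+_ (F [] n)) (sumOver-+ (wordsUpTo n) (λ w → F (one ∷ w) n) (λ w → F (two ∷ w) n)) ⟩
  F [] n + (Σʷ (λ w → F (one ∷ w)) n + Σʷ (λ w → F (two ∷ w)) n)
    ≡⟨ ℤP.+-assoc (F [] n) _ _ ⟨
  F [] n + Σʷ (λ w → F (one ∷ w)) n + Σʷ (λ w → F (two ∷ w)) n ∎
  where open ≡-Reasoning

Σʷ-⊛ʳ : ∀ F c → Summable F → Σʷ (λ w → F w ⊛ c) ≈ Σʷ F ⊛ c
Σʷ-⊛ʳ F c F-summable n = begin
  sumOver (wordsUpTo n) (λ w → sumTo n (λ k → F w k * c (n ∸ k)))
    ≡⟨ sumOver-sumTo (wordsUpTo n) n _ ⟩
  sumTo n (λ k → sumOver (wordsUpTo n) (λ w → F w k * c (n ∸ k)))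
    ≡⟨ sumTo-cong′ n (λ k → sumOver-*ʳ (wordsUpTo n) (c (n ∸ k)) (λ w → F w k)) ⟨
  sumTo n (λ k → sumOver (wordsUpTo n) (λ w → F w k) * c (n ∸ k))
    ≡⟨ sumTo-cong n (λ k k≤n → cong (_* c (n ∸ k))
                                    (sumOver-wordsUpTo-≤ (λ w → F w k) (λ w → F-summable w k) k≤n)) ⟩
  sumTo n (λ k → Σʷ F k * c (n ∸ k)) ∎
  where open ≡-Reasoning

Σʷ-δ : ∀ F → Summable F → ∀ u → Σʷ (λ w → δ u w ·ₛ F w) ≈ F u
Σʷ-δ F F-summable [] = begin
  Σʷ (λ w → δ [] w ·ₛ F w)                          ≈⟨ Σʷ-unfold _ (summable-·ₛ (δ []) F F-summable) ⟩
  1ℤ ·ₛ F [] ⊕ Σʷ (λ w → 0ℤ ·ₛ F (one ∷ w)) ⊕ Σʷ (λ w → 0ℤ ·ₛ F (two ∷ w))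
    ≈⟨ ⊕-cong (⊕-cong (λ n → ℤP.*-identityˡ (F [] n)) Σʷ-zero) Σʷ-zero ⟩
  F [] ⊕ 0ₛ ⊕ 0ₛ                                    ≈⟨ solve 1 (λ f → f :+ con 0 :+ con 0 := f) ≈-refl (F []) ⟩
  F []                                              ∎
  where open ≈-Reasoning
Σʷ-δ F F-summable (one ∷ u) = begin
  Σʷ (λ w → δ (one ∷ u) w ·ₛ F w)                   ≈⟨ Σʷ-unfold _ (summable-·ₛ (δ (one ∷ u)) F F-summable) ⟩
  0ₛ ⊕ Σʷ (λ w → δ u w ·ₛ F (one ∷ w)) ⊕ Σʷ (λ w → 0ℤ ·ₛ F (two ∷ w))
    ≈⟨ ⊕-cong (⊕-cong (≈-refl {0ₛ}) (Σʷ-δ (λ w → F (one ∷ w)) (summable-∷ one F F-summable) u)) Σʷ-zero ⟩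
  0ₛ ⊕ F (one ∷ u) ⊕ 0ₛ                             ≈⟨ solve 1 (λ f → con 0 :+ f :+ con 0 := f) ≈-refl (F (one ∷ u)) ⟩
  F (one ∷ u)                                       ∎
  where open ≈-Reasoning
Σʷ-δ F F-summable (two ∷ u) = begin
  Σʷ (λ w → δ (two ∷ u) w ·ₛ F w)                   ≈⟨ Σʷ-unfold _ (summable-·ₛ (δ (two ∷ u)) F F-summable) ⟩
  0ₛ ⊕ Σʷ (λ w → 0ℤ ·ₛ F (one ∷ w)) ⊕ Σʷ (λ w → δ u w ·ₛ F (two ∷ w))
    ≈⟨ ⊕-cong (⊕-cong (≈-refl {0ₛ}) Σʷ-zero) (Σʷ-δ (λ w → F (two ∷ w)) (summable-∷ two F F-summable) u) ⟩
  0ₛ ⊕ 0ₛ ⊕ F (two ∷ u)                             ≈⟨ solve 1 (λ f → con 0 :+ con 0 :+ f := f) ≈-refl (F (two ∷ u)) ⟩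
  F (two ∷ u)                                       ∎
  where open ≈-Reasoning

ζ-length : ∀ v w → length w ℕ.< length v → ζ v w ≡ 0ℤ
ζ-length v w ∣w∣<∣v∣ with sublist? (λ x y → val x ℕ.≤? val y) v w
... | yes v≼w = ⊥-elim (ℕP.<⇒≱ ∣w∣<∣v∣ (length-mono-≤ v≼w))
... | no  _   = refl

ζ^-suc-wordsUpTo : ∀ m u w {N} → length w ℕ.≤ N →
  ζ^ (suc m) u w ≡ sumOver (wordsUpTo N) (λ v → ζ^ m u v * ζ v w)
ζ^-suc-wordsUpTo m u w ∣w∣≤N = sym (sumOver-wordsUpTo-≤ _
  (λ v ∣w∣<∣v∣ → trans (cong (ζ^ m u v *_) (ζ-length v w ∣w∣<∣v∣)) (ℤP.*-zeroʳ (ζ^ m u v))) ∣w∣≤N)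

Σʷ-ζ^-suc : ∀ m u F → Summable F →
  Σʷ (λ w → ζ^ (suc m) u w ·ₛ F w) ≈ Σʷ (λ v → ζ^ m u v ·ₛ Σʷ (λ w → ζ v w ·ₛ F w))
Σʷ-ζ^-suc m u F F-summable n = begin
  sumOver U (λ w → ζ^ (suc m) u w * F w n)                        ≡⟨ sumOver-cong U expand ⟩
  sumOver U (λ w → sumOver U (λ v → ζ^ m u v * ζ v w) * F w n)
    ≡⟨ sumOver-cong U (λ w → sumOver-*ʳ U (F w n) (λ v → ζ^ m u v * ζ v w)) ⟩
  sumOver U (λ w → sumOver U (λ v → ζ^ m u v * ζ v w * F w n))
    ≡⟨ sumOver-swap U U (λ w v → ζ^ m u v * ζ v w * F w n) ⟩
  sumOver U (λ v → sumOver U (λ w → ζ^ m u v * ζ v w * F w n))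
    ≡⟨ sumOver-cong U (λ v → trans (sumOver-cong U (λ w → ℤP.*-assoc (ζ^ m u v) (ζ v w) (F w n)))
                                   (sym (sumOver-*ˡ U (ζ^ m u v) _))) ⟩
  sumOver U (λ v → ζ^ m u v * sumOver U (λ w → ζ v w * F w n))   ∎
  where
  open ≡-Reasoning
  U = wordsUpTo n
  expand : ∀ w → ζ^ (suc m) u w * F w n ≡ sumOver U (λ v → ζ^ m u v * ζ v w) * F w n
  expand w with length w ℕ.≤? n
  ... | yes ∣w∣≤n = cong (_* F w n) (ζ^-suc-wordsUpTo m u w ∣w∣≤n)
  ... | no  ∣w∣≰n = begin
    ζ^ (suc m) u w * F w n                         ≡⟨ cong (ζ^ (suc m) u w *_) Fwn≡0 ⟩
    ζ^ (suc m) u w * 0ℤ                            ≡⟨ ℤP.*-zeroʳ (ζ^ (suc m) u w) ⟩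
    0ℤ                                             ≡⟨ ℤP.*-zeroʳ (sumOver U (λ v → ζ^ m u v * ζ v w)) ⟨
    sumOver U (λ v → ζ^ m u v * ζ v w) * 0ℤ        ≡⟨ cong (sumOver U (λ v → ζ^ m u v * ζ v w) *_) Fwn≡0 ⟨
    sumOver U (λ v → ζ^ m u v * ζ v w) * F w n     ∎
    where
    Fwn≡0 : F w n ≡ 0ℤ
    Fwn≡0 = F-summable w n (ℕP.≰⇒> ∣w∣≰n)

-- Weighted zeta sums

weight : Series × Series → Word → Series
weight p []        = 𝟙
weight p (one ∷ w) = weight p w ⊛ proj₁ p
weight p (two ∷ w) = weight p w ⊛ proj₂ p

weight-summable : ∀ p → BothConstantFree p → Summable (weight p)
weight-summable p p-cf []        k ()
weight-summable p p-cf (one ∷ w) = subst (x^_∣ (weight p w ⊛ proj₁ p)) (ℕP.+-comm (length w) 1)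
  (x^-∣-⊛ (length w) 1 {weight p w} {proj₁ p} (weight-summable p p-cf w) (x^1∣ (proj₁ p-cf)))
weight-summable p p-cf (two ∷ w) = subst (x^_∣ (weight p w ⊛ proj₂ p)) (ℕP.+-comm (length w) 1)
  (x^-∣-⊛ (length w) 1 {weight p w} {proj₂ p} (weight-summable p p-cf w) (x^1∣ (proj₂ p-cf)))

inv[𝟙⊖α⊖β] : Series × Series → Series
inv[𝟙⊖α⊖β] (α , β) = inv (𝟙 ⊖ α ⊖ β)

ζ-sum : Series × Series → Word → Series
ζ-sum p v = Σʷ (λ w → ζ v w ·ₛ weight p w)

module _ (p : Series × Series) (p-cf : BothConstantFree p) where
  private
    α = proj₁ p
    β = proj₂ p

    ζ-sum-⊛ʳ : ∀ v γ → Σʷ (λ w → ζ v w ·ₛ (weight p w ⊛ γ)) ≈ ζ-sum p v ⊛ γ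
    ζ-sum-⊛ʳ v γ = ≈-trans (Σʷ-cong (λ w → ·ₛ-⊛ (ζ v w) (weight p w) γ))
                           (Σʷ-⊛ʳ _ γ (summable-·ₛ (ζ v) (weight p) (weight-summable p p-cf)))

    unfold : ∀ v → ζ-sum p v ≈ ζ v [] ·ₛ 𝟙 ⊕ Σʷ (λ w → ζ v (one ∷ w) ·ₛ (weight p w ⊛ α))
                                          ⊕ Σʷ (λ w → ζ v (two ∷ w) ·ₛ (weight p w ⊛ β))
    unfold v = Σʷ-unfold _ (summable-·ₛ (ζ v) (weight p) (weight-summable p p-cf))

  ζ-sum-[] : ζ-sum p [] ≈ 𝟙 ⊕ ζ-sum p [] ⊛ (α ⊕ β)
  ζ-sum-[] = begin
    ζ-sum p []                                           ≈⟨ unfold [] ⟩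
    1ℤ ·ₛ 𝟙 ⊕ Σʷ (λ w → ζ [] w ·ₛ (weight p w ⊛ α)) ⊕ Σʷ (λ w → ζ [] w ·ₛ (weight p w ⊛ β))
      ≈⟨ ⊕-cong (⊕-cong (λ n → ℤP.*-identityˡ (𝟙 n)) (ζ-sum-⊛ʳ [] α)) (ζ-sum-⊛ʳ [] β) ⟩
    𝟙 ⊕ ζ-sum p [] ⊛ α ⊕ ζ-sum p [] ⊛ β
      ≈⟨ solve 3 (λ k α β → con 1 :+ k :* α :+ k :* β := con 1 :+ k :* (α :+ β)) ≈-refl (ζ-sum p []) α β ⟩
    𝟙 ⊕ ζ-sum p [] ⊛ (α ⊕ β)                             ∎
    where open ≈-Reasoning

  ζ-sum-one : ∀ v → ζ-sum p (one ∷ v) ≈ ζ-sum p v ⊛ (α ⊕ β)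
  ζ-sum-one v = begin
    ζ-sum p (one ∷ v)                                    ≈⟨ unfold (one ∷ v) ⟩
    0ₛ ⊕ Σʷ (λ w → ζ v w ·ₛ (weight p w ⊛ α)) ⊕ Σʷ (λ w → ζ v w ·ₛ (weight p w ⊛ β))
      ≈⟨ ⊕-cong (⊕-cong (≈-refl {0ₛ}) (ζ-sum-⊛ʳ v α)) (ζ-sum-⊛ʳ v β) ⟩
    0ₛ ⊕ ζ-sum p v ⊛ α ⊕ ζ-sum p v ⊛ β
      ≈⟨ solve 3 (λ k α β → con 0 :+ k :* α :+ k :* β := k :* (α :+ β)) ≈-refl (ζ-sum p v) α β ⟩
    ζ-sum p v ⊛ (α ⊕ β)                                  ∎
    where open ≈-Reasoning

  ζ-sum-two : ∀ v → ζ-sum p (two ∷ v) ≈ ζ-sum p v ⊛ β ⊕ ζ-sum p (two ∷ v) ⊛ α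
  ζ-sum-two v = begin
    ζ-sum p (two ∷ v)                                    ≈⟨ unfold (two ∷ v) ⟩
    0ₛ ⊕ Σʷ (λ w → ζ (two ∷ v) w ·ₛ (weight p w ⊛ α)) ⊕ Σʷ (λ w → ζ v w ·ₛ (weight p w ⊛ β))
      ≈⟨ ⊕-cong (⊕-cong (≈-refl {0ₛ}) (ζ-sum-⊛ʳ (two ∷ v) α)) (ζ-sum-⊛ʳ v β) ⟩
    0ₛ ⊕ ζ-sum p (two ∷ v) ⊛ α ⊕ ζ-sum p v ⊛ β
      ≈⟨ solve 4 (λ k k′ α β → con 0 :+ k′ :* α :+ k :* β := k :* β :+ k′ :* α)
                 ≈-refl (ζ-sum p v) (ζ-sum p (two ∷ v)) α β ⟩
    ζ-sum p v ⊛ β ⊕ ζ-sum p (two ∷ v) ⊛ α                ∎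
    where open ≈-Reasoning

  ζ-sum≈weight-step : ∀ v → ζ-sum p v ≈ weight (step p) v ⊛ inv[𝟙⊖α⊖β] p
  ζ-sum≈weight-step [] =
    x⊛u≈y⇒x≈y⊛inv-u (𝟙 ⊖ α ⊖ β) (cong₂ (λ x y → 1ℤ ℤ.- x ℤ.- y) (proj₁ p-cf) (proj₂ p-cf)) (begin
      ζ-sum p [] ⊛ (𝟙 ⊖ α ⊖ β)      ≈⟨ ⊛-cong (≈-refl {ζ-sum p []}) (λ n → sub-sub (𝟙 n) (α n) (β n)) ⟩
      ζ-sum p [] ⊛ (𝟙 ⊖ (α ⊕ β))    ≈⟨ y≈p⊕y⊛c⇒y⊛[𝟙⊖c]≈p (ζ-sum p []) 𝟙 (α ⊕ β) ζ-sum-[] ⟩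
      𝟙                             ∎)
    where
    open ≈-Reasoning
    sub-sub : ∀ x y z → x ℤ.- y ℤ.- z ≡ x ℤ.- (y + z)
    sub-sub = solve-∀
  ζ-sum≈weight-step (one ∷ v) = begin
    ζ-sum p (one ∷ v)                  ≈⟨ ζ-sum-one v ⟩
    ζ-sum p v ⊛ (α ⊕ β)                ≈⟨ ⊛-cong (ζ-sum≈weight-step v) (≈-refl {α ⊕ β}) ⟩
    weight (step p) v ⊛ c ⊛ (α ⊕ β)
      ≈⟨ solve 3 (λ w c α′ → w :* c :* α′ := w :* α′ :* c) ≈-refl (weight (step p) v) c (α ⊕ β) ⟩
    weight (step p) v ⊛ (α ⊕ β) ⊛ c    ∎
    where
    open ≈-Reasoning
    c = inv[𝟙⊖α⊖β] p
  ζ-sum≈weight-step (two ∷ v) = begin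
    ζ-sum p (two ∷ v)
      ≈⟨ x⊛u≈y⇒x≈y⊛inv-u (𝟙 ⊖ α) (cong (λ x → 1ℤ ℤ.- x) (proj₁ p-cf))
           (y≈p⊕y⊛c⇒y⊛[𝟙⊖c]≈p (ζ-sum p (two ∷ v)) (ζ-sum p v ⊛ β) α (ζ-sum-two v)) ⟩
    ζ-sum p v ⊛ β ⊛ inv (𝟙 ⊖ α)
      ≈⟨ ⊛-cong (⊛-cong (ζ-sum≈weight-step v) (≈-refl {β})) (≈-refl {inv (𝟙 ⊖ α)}) ⟩
    weight (step p) v ⊛ c ⊛ β ⊛ inv (𝟙 ⊖ α)
      ≈⟨ solve 4 (λ w c β i → w :* c :* β :* i := w :* (β :* i) :* c) ≈-refl (weight (step p) v) c β (inv (𝟙 ⊖ α)) ⟩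
    weight (step p) v ⊛ (β ⊛ inv (𝟙 ⊖ α)) ⊛ c ∎
    where
    open ≈-Reasoning
    c = inv[𝟙⊖α⊖β] p

prodBelow-cong : ∀ m {f g : ℕ → Series} → (∀ i → f i ≈ g i) → prodBelow m f ≈ prodBelow m g
prodBelow-cong zero    f≈g = ≈-refl
prodBelow-cong (suc m) f≈g = ⊛-cong (prodBelow-cong m f≈g) (f≈g m)

prodBelow-suc : ∀ m (f : ℕ → Series) → prodBelow m (λ i → f (suc i)) ⊛ f 0 ≈ prodBelow (suc m) f
prodBelow-suc zero    f = ≈-refl
prodBelow-suc (suc m) f = begin
  prodBelow m (λ i → f (suc i)) ⊛ f (suc m) ⊛ f 0
    ≈⟨ solve 3 (λ q x y → q :* x :* y := q :* y :* x) ≈-refl (prodBelow m (λ i → f (suc i))) (f (suc m)) (f 0) ⟩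
  prodBelow m (λ i → f (suc i)) ⊛ f 0 ⊛ f (suc m)   ≈⟨ ⊛-cong (prodBelow-suc m f) (≈-refl {f (suc m)}) ⟩
  prodBelow (suc m) f ⊛ f (suc m)                   ∎
  where open ≈-Reasoning

Σʷ-ζ^-weight : ∀ m p → BothConstantFree p → ∀ u →
  Σʷ (λ w → ζ^ m u w ·ₛ weight p w)
    ≈ weight (iterate step p m) u ⊛ prodBelow m (λ i → inv[𝟙⊖α⊖β] (iterate step p i))
Σʷ-ζ^-weight zero    p p-cf u =
  ≈-trans (Σʷ-δ (weight p) (weight-summable p p-cf) u) (≈-sym (⊛-identityʳ (weight p u)))
Σʷ-ζ^-weight (suc m) p p-cf u = begin
  Σʷ (λ w → ζ^ (suc m) u w ·ₛ weight p w)   ≈⟨ Σʷ-ζ^-suc m u (weight p) (weight-summable p p-cf) ⟩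
  Σʷ (λ v → ζ^ m u v ·ₛ ζ-sum p v)
    ≈⟨ Σʷ-cong (λ v n → cong (ζ^ m u v *_) (ζ-sum≈weight-step p p-cf v n)) ⟩
  Σʷ (λ v → ζ^ m u v ·ₛ (weight p′ v ⊛ c))  ≈⟨ Σʷ-cong (λ v → ·ₛ-⊛ (ζ^ m u v) (weight p′ v) c) ⟩
  Σʷ (λ v → (ζ^ m u v ·ₛ weight p′ v) ⊛ c)
    ≈⟨ Σʷ-⊛ʳ _ c (summable-·ₛ (ζ^ m u) (weight p′) (weight-summable p′ p′-cf)) ⟩
  Σʷ (λ v → ζ^ m u v ·ₛ weight p′ v) ⊛ c    ≈⟨ ⊛-cong (Σʷ-ζ^-weight m p′ p′-cf u) (≈-refl {c}) ⟩
  weight (iterate step p′ m) u ⊛ Π ⊛ c      ≈⟨ ⊛-assoc (weight (iterate step p′ m) u) Π c ⟩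
  weight (iterate step p′ m) u ⊛ (Π ⊛ c)
    ≈⟨ ⊛-cong (≈-refl {weight (iterate step p′ m) u}) (prodBelow-suc m (λ i → inv[𝟙⊖α⊖β] (iterate step p i))) ⟩
  weight (iterate step p (suc m)) u ⊛ prodBelow (suc m) (λ i → inv[𝟙⊖α⊖β] (iterate step p i)) ∎
  where
  open ≈-Reasoning
  p′ = step p
  p′-cf = step-constantFree p p-cf
  c = inv[𝟙⊖α⊖β] p
  Π = prodBelow m (λ i → inv[𝟙⊖α⊖β] (iterate step p′ i))

-- Specialisation to (α , β) = (x , x²)

monomial : ℕ → Series
monomial k n = if does (k ℕ.≟ n) then 1ℤ else 0ℤ

X⊛monomial : ∀ k → X ⊛ monomial k ≈ monomial (suc k)
X⊛monomial k zero    = refl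
X⊛monomial k (suc n) = X⊛-suc (monomial k) n

weight-monomial : ∀ w → weight (X , X ⊛ X) w ≈ monomial ∣ w ∣ʷ
weight-monomial []        zero    = refl
weight-monomial []        (suc n) = refl
weight-monomial (one ∷ w) = begin
  weight (X , X ⊛ X) w ⊛ X      ≈⟨ ⊛-comm (weight (X , X ⊛ X) w) X ⟩
  X ⊛ weight (X , X ⊛ X) w      ≈⟨ ⊛-cong (≈-refl {X}) (weight-monomial w) ⟩
  X ⊛ monomial ∣ w ∣ʷ           ≈⟨ X⊛monomial ∣ w ∣ʷ ⟩
  monomial (suc ∣ w ∣ʷ)         ∎
  where open ≈-Reasoning
weight-monomial (two ∷ w) = begin
  weight (X , X ⊛ X) w ⊛ (X ⊛ X)   ≈⟨ solve 2 (λ v x → v :* (x :* x) := x :* (x :* v)) ≈-refl (weight (X , X ⊛ X) w) X ⟩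
  X ⊛ (X ⊛ weight (X , X ⊛ X) w)   ≈⟨ ⊛-cong (≈-refl {X}) (⊛-cong (≈-refl {X}) (weight-monomial w)) ⟩
  X ⊛ (X ⊛ monomial ∣ w ∣ʷ)        ≈⟨ ⊛-cong (≈-refl {X}) (X⊛monomial ∣ w ∣ʷ) ⟩
  X ⊛ monomial (suc ∣ w ∣ʷ)        ≈⟨ X⊛monomial (suc ∣ w ∣ʷ) ⟩
  monomial (suc (suc ∣ w ∣ʷ))      ∎
  where open ≈-Reasoning

genSeries≈Σʷ : ∀ m u → genSeries m u ≈ Σʷ (λ w → ζ^ m u w ·ₛ weight (X , X ⊛ X) w)
genSeries≈Σʷ m u n = trans (sumOver-filter (λ w → ∣ w ∣ʷ ℕ.≟ n) (wordsUpTo n) (ζ^ m u))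
  (sumOver-cong (wordsUpTo n) (λ w → trans (if-then-else-0 (does (∣ w ∣ʷ ℕ.≟ n)) (ζ^ m u w))
                                           (cong (ζ^ m u w *_) (sym (weight-monomial w n)))))
  where
  if-then-else-0 : ∀ b z → (if b then z else 0ℤ) ≡ z * (if b then 1ℤ else 0ℤ)
  if-then-else-0 true  z = sym (ℤP.*-identityʳ z)
  if-then-else-0 false z = sym (ℤP.*-zeroʳ z)

weight-count : ∀ p u → weight p u ≈ (proj₁ p ^ₛ count₁ u) ⊛ (proj₂ p ^ₛ count₂ u)
weight-count p []        = ≈-sym (⊛-identityˡ 𝟙)
weight-count p (one ∷ u) = ≈-trans (⊛-cong (weight-count p u) (≈-refl {proj₁ p}))
  (solve 3 (λ x y α → x :* y :* α := α :* x :* y) ≈-refl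
           (proj₁ p ^ₛ count₁ u) (proj₂ p ^ₛ count₂ u) (proj₁ p))
weight-count p (two ∷ u) = ≈-trans (⊛-cong (weight-count p u) (≈-refl {proj₂ p}))
  (solve 3 (λ x y β → x :* y :* β := x :* (β :* y)) ≈-refl
           (proj₁ p ^ₛ count₁ u) (proj₂ p ^ₛ count₂ u) (proj₂ p))

genSeries-formula : ∀ m u →
  genSeries m u ≈ (a m ^ₛ count₁ u) ⊛ (b m ^ₛ count₂ u) ⊛ prodBelow m (λ i → inv (𝟙 ⊖ a i ⊖ b i))
genSeries-formula m u = begin
  genSeries m u                                                    ≈⟨ genSeries≈Σʷ m u ⟩
  Σʷ (λ w → ζ^ m u w ·ₛ weight p₀ w)                               ≈⟨ Σʷ-ζ^-weight m p₀ (refl , refl) u ⟩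
  weight (iterate step p₀ m) u ⊛ prodBelow m (λ i → inv[𝟙⊖α⊖β] (iterate step p₀ i))
    ≈⟨ ⊛-cong (≈-reflexive (cong (λ p → weight p u) (ab-iterate m)))
              (prodBelow-cong m (λ i → ≈-reflexive (cong inv[𝟙⊖α⊖β] (ab-iterate i)))) ⟩
  weight (a m , b m) u ⊛ Π                                         ≈⟨ ⊛-cong (weight-count (a m , b m) u) (≈-refl {Π}) ⟩
  (a m ^ₛ count₁ u) ⊛ (b m ^ₛ count₂ u) ⊛ Π                        ∎
  where
  open ≈-Reasoning
  p₀ = (X , X ⊛ X)
  Π = prodBelow m (λ i → inv (𝟙 ⊖ a i ⊖ b i))

mainTheorem5 :
    ((m : ℕ) (u : Word) →
      genSeries m u ≈
        (a m ^ₛ count₁ u) ⊛ (b m ^ₛ count₂ u)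
          ⊛ prodBelow m (λ i → inv (𝟙 ⊖ a i ⊖ b i)))
    × ((m : ℕ) →
      (a m ≈ X ⊛ abar m ⊛ inv (d m))
      × (b m ≈ (X ⊛ X) ⊛ inv (d m ⊛ d (suc m))))
mainTheorem5 = genSeries-formula , closed-forms
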